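{- Let $\mathcal{H}=(V,E)$ be a connected hypergraph, let $e_1,e_2$ be two distinct hyperedges of $\mathcal{H}$, and let $f_1,f_2$ be hypertrees of $\mathcal{H}$ with $f_1(e_1)<f_2(e_1)$ and $f_1(e)=f_2(e)$ for every $e\in E\setminus\{e_1,e_2\}$. Let $e,e'$ be two distinct hyperedges in $E\setminus\{e_1,e_2\}$. Then: (1) if neither $e$ nor $e_2$ can transfer valence to $e'$ with respect to $f_1$, then neither $e$ nor $e_2$ can transfer valence to $e'$ with respect to $f_2$; (2) if $e$ can transfer valence to neither $e_1$ nor $e'$ with respect to $f_1$, then $e$ can transfer valence to neither $e_1$ nor $e'$ with respect to $f_2$.
   Context: A hypergraph is a pair $\mathcal{H}=(V,E)$ with $V$ a finite set and $E$ a finite multiset of nonempty subsets of $V$ (hyperedges). Its associated bipartite graph $\mathrm{Bip}\,\mathcal{H}$ has colour classes $V$ and $E$, with $v\in V$ adjacent to $e\in E$ iff $v\in e$; $\mathcal{H}$ is connected if $\mathrm{Bip}\,\mathcal{H}$ is connected. A hypertree of $\mathcal{H}$ is a function $f:E\to\mathbb{N}=\{0,1,2,\dots\}$ such that there is a spanning tree $\tau$ of $\mathrm{Bip}\,\mathcal{H}$ with $d_\tau(e)=f(e)+1$ for all $e\in E$. For distinct hyperedges $a,b$, $a$ can transfer valence to $b$ with respect to a hypertree $f$ if the function obtained from $f$ by decreasing $f(a)$ by $1$ and increasing $f(b)$ by $1$ is also a hypertree. -}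

module Defs where

open import Data.Nat using (ℕ; zero; suc; _+_; _≤_)
open import Data.Fin using (Fin)
open import Data.Bool using (Bool; true; false; if_then_else_)
open import Data.Sum using (_⊎_; inj₁; inj₂)
open import Data.Product using (Σ; ∃; ∃₂; _×_; _,_)
open import Data.Empty using (⊥)
open import Data.List using (List; []; _∷_; _++_; [_]; length; allFin; map)
open import Data.Nat.ListAction using (sum)
open import Data.List.Relation.Unary.Unique.Propositional using (Unique)
open import Data.List.Relation.Unary.Linked using (Linked)
open import Relation.Nullary using (¬_)
open import Relation.Binary.PropositionalEquality using (_≡_; _≢_)

-- A hypergraph with vertex set V = Fin nV and hyperedges indexed by Fin nE
-- (indexing realises E as a multiset: distinct indices may carry equal sets).
-- inc e v ≡ true  means  v ∈ e.
record Hypergraph : Set where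
  field
    nV nE    : ℕ
    inc      : Fin nE → Fin nV → Bool
    nonempty : ∀ e → ∃ λ v → inc e v ≡ true

module _ (H : Hypergraph) where
  open Hypergraph H

  -- vertices of Bip H : colour classes V and E
  Node : Set
  Node = Fin nV ⊎ Fin nE

  EdgeSet : Set
  EdgeSet = Fin nE → Fin nV → Bool

  Adj : EdgeSet → Node → Node → Set
  Adj T (inj₁ v) (inj₂ e) = T e v ≡ true
  Adj T (inj₂ e) (inj₁ v) = T e v ≡ true
  Adj T (inj₁ _) (inj₁ _) = ⊥
  Adj T (inj₂ _) (inj₂ _) = ⊥

  data Walk (T : EdgeSet) : Node → Node → Set where
    here : ∀ {x} → Walk T x x
    step : ∀ {x y z} → Adj T x y → Walk T y z → Walk T x z

  GConnected : EdgeSet → Set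
  GConnected T = ∀ x y → Walk T x y

  HasCycle : EdgeSet → Set
  HasCycle T = ∃₂ λ x ys → (2 ≤ length ys) × Unique (x ∷ ys)
                          × Linked (Adj T) (x ∷ ys ++ [ x ])

  SpanningTree : EdgeSet → Set
  SpanningTree T = (∀ e v → T e v ≡ true → inc e v ≡ true)
                 × GConnected T × ¬ HasCycle T

  deg : EdgeSet → Fin nE → ℕ
  deg T e = sum (map (λ v → if T e v then 1 else 0) (allFin nV))

  Connected : Set
  Connected = GConnected inc

  IsHypertree : (Fin nE → ℕ) → Set
  IsHypertree f = Σ EdgeSet λ T → SpanningTree T × (∀ e → deg T e ≡ suc (f e))

  -- a can transfer valence to b w.r.t. f: the function g with g a = f a - 1,
  -- g b = f b + 1, g x = f x otherwise, is (well defined, i.e. f a ≥ 1, and) a hypertree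
  CanTransfer : (Fin nE → ℕ) → Fin nE → Fin nE → Set
  CanTransfer f a b = Σ (Fin nE → ℕ) λ g →
      suc (g a) ≡ f a × g b ≡ suc (f b)
    × (∀ x → x ≢ a → x ≢ b → g x ≡ f x)
    × IsHypertree g

-- Hypertrees are the degree vectors (shifted by one) of spanning trees of Bip H, and they obey the
-- exchange property of matroid bases: if g a < f a then f can transfer valence from a to some b
-- with f b < g b, and dually if f b < g b then f can transfer valence into b from some a with
-- g a < f a. Both come from swapping a tree edge for an edge of the other tree across a
-- fundamental cut (resp. along a fundamental cycle), repeated until the surplus reaches a
-- hyperedge that wants it; each swap brings the tree one edge closer to the other one.
--
-- In (1), a transfer a → e′ for f₂ yields a hypertree g with g e′ > f₁ e′, so f₁ can transfer
-- into e′ from some c with g c < f₁ c, and as f₁, f₂ agree off {e₁, e₂} with f₁ e₁ < f₂ e₁ this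
-- forces c ∈ {a, e₂}. In (2), a transfer e → b for f₂ yields g with g e < f₁ e, so f₁ can
-- transfer from e to some c with f₁ c < g c; the exchange property also gives f₂ e₂ < f₁ e₂,
-- which forces c ∈ {b, e₁}.
module Submission where

open import Defs
open import Data.Nat using (ℕ; zero; suc; pred; _+_; _≤_; _<_; _<?_; _≤?_; z≤n; s≤s; z<s; >-nonZero)
open import Data.Nat.Properties
open import Data.Fin using (Fin; zero; suc) renaming (_≟_ to _≟ᶠ_)
open import Data.Fin.Base using (punchIn)
open import Data.Fin.Properties using (¬∀⟶∃¬; punchInᵢ≢i)
open import Data.Bool using (Bool; true; false; if_then_else_; _∧_)
open import Data.Bool.Properties using (¬-not; not-¬)
open import Data.Sum using (_⊎_; inj₁; inj₂)
open import Data.Sum.Properties using (≡-dec)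
open import Data.Product using (Σ; ∃; ∃₂; _×_; _,_; proj₁; proj₂; map₂)
open import Data.Empty using (⊥; ⊥-elim)
open import Data.List using (List; []; _∷_; _++_; [_]; map; allFin; tabulate)
open import Data.List.Properties using (map-tabulate)
import Data.Nat.ListAction as ListAction
open import Algebra.Properties.CommutativeMonoid.Sum +-0-commutativeMonoid
  using (sum; sum-cong-≗; sum-remove)
open import Data.List.Relation.Unary.All using (All; []; _∷_)
open import Data.List.Relation.Unary.All.Properties using (¬Any⇒All¬; All¬⇒¬Any)
open import Data.List.Relation.Unary.Any using (here; there)
open import Data.List.Relation.Unary.AllPairs using ([]; _∷_)
open import Data.List.Relation.Unary.Unique.Propositional using (Unique)
open import Data.List.Relation.Unary.Linked using (Linked; [-]; _∷_)
open import Data.List.Membership.Propositional using (_∈_)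
import Data.List.Membership.DecPropositional as DecMembership
open import Relation.Nullary using (¬_; Dec; yes; no; does)
open import Relation.Binary.PropositionalEquality
  using (_≡_; _≢_; _≗_; refl; sym; trans; cong; cong₂; subst; subst₂; module ≡-Reasoning)
open import Function using (_∘_; id)
open import Induction.WellFounded using (Acc; acc)
open import Data.Nat.Induction using (<-wellFounded)
open ≡-Reasoning

sum-allFin : ∀ n (h : Fin n → ℕ) → ListAction.sum (map h (allFin n)) ≡ sum h
sum-allFin zero h = refl
sum-allFin (suc n) h = cong (h zero +_) (begin
  ListAction.sum (map h (tabulate suc))         ≡⟨ cong ListAction.sum (map-tabulate suc h) ⟩
  ListAction.sum (tabulate (h ∘ suc))           ≡⟨ cong ListAction.sum (map-tabulate id (h ∘ suc)) ⟨
  ListAction.sum (map (h ∘ suc) (allFin n))     ≡⟨ sum-allFin n (h ∘ suc) ⟩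
  sum (h ∘ suc)                                 ∎)

sum-mono-≤ : ∀ {n} {h h′ : Fin n → ℕ} → (∀ x → h x ≤ h′ x) → sum h ≤ sum h′
sum-mono-≤ {zero} _ = z≤n
sum-mono-≤ {suc n} h≤h′ = +-mono-≤ (h≤h′ zero) (sum-mono-≤ (h≤h′ ∘ suc))

sum<⇒∃< : ∀ {n} {h h′ : Fin n → ℕ} → sum h < sum h′ → ∃ λ x → h x < h′ x
sum<⇒∃< {n} {h} {h′} lt =
  map₂ ≰⇒> (¬∀⟶∃¬ n (λ x → h′ x ≤ h x) (λ x → h′ x ≤? h x) λ h′≤h → <⇒≱ lt (sum-mono-≤ h′≤h))

sum-suc-at : ∀ {n} {h h′ : Fin n → ℕ} w → (∀ x → x ≢ w → h x ≡ h′ x) → h w ≡ suc (h′ w) →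
             sum h ≡ suc (sum h′)
sum-suc-at {suc n} {h} {h′} w elsewhere at-w = begin
  sum h                                  ≡⟨ sum-remove h ⟩
  h w + sum (h ∘ punchIn w)              ≡⟨ cong₂ _+_ at-w (sum-cong-≗ λ x → elsewhere _ (punchInᵢ≢i w x)) ⟩
  suc (h′ w + sum (h′ ∘ punchIn w))      ≡⟨ cong suc (sum-remove h′) ⟨
  suc (sum h′)                           ∎

-- Moving valence

Transfer : ∀ {n} → (Fin n → ℕ) → Fin n → Fin n → (Fin n → ℕ) → Set
Transfer f a b g = suc (g a) ≡ f a × g b ≡ suc (f b) × (∀ x → x ≢ a → x ≢ b → g x ≡ f x)

transfer⇒≢ : ∀ {n} {f g : Fin n → ℕ} {a b} → Transfer f a b g → a ≢ b
transfer⇒≢ {f = f} {a = a} (ga , gb , _) refl =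
  <⇒≢ (<-trans (n<1+n (f a)) (n<1+n (suc (f a)))) (trans (sym ga) (cong suc gb))

transfer-congˡ : ∀ {n} {f f′ g : Fin n → ℕ} {a b} → f ≗ f′ → Transfer f a b g → Transfer f′ a b g
transfer-congˡ f≗f′ (ga , gb , g≗f) =
  trans ga (f≗f′ _) , trans gb (cong suc (f≗f′ _)) , λ x x≢a x≢b → trans (g≗f x x≢a x≢b) (f≗f′ x)

transfer-trans : ∀ {n} {f g h : Fin n → ℕ} {a b c} →
                 Transfer f a b g → Transfer g b c h → a ≢ c → Transfer f a c h
transfer-trans {f = f} {h = h} {a} {b} {c} f→g@(ga , gb , g≗f) g→h@(hb , hc , h≗g) a≢c =
  trans (cong suc (h≗g a a≢b a≢c)) ga ,
  trans hc (cong suc (g≗f c (a≢c ∘ sym) (b≢c ∘ sym))) ,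
  h≗f
  where
  a≢b : a ≢ b
  a≢b = transfer⇒≢ f→g
  b≢c : b ≢ c
  b≢c = transfer⇒≢ g→h
  h≗f : ∀ x → x ≢ a → x ≢ c → h x ≡ f x
  h≗f x x≢a x≢c with x ≟ᶠ b
  ... | yes refl = suc-injective (trans hb gb)
  ... | no x≢b = trans (h≗g x x≢b x≢c) (g≗f x x≢a x≢b)

transfer-trans′ : ∀ {n} {f g h : Fin n → ℕ} {a b c} →
                  Transfer f b c g → Transfer g a b h → a ≢ c → Transfer f a c h
transfer-trans′ {f = f} {h = h} {a} {b} {c} f→g@(gb , gc , g≗f) g→h@(ha , hb , h≗g) a≢c =
  trans ha (g≗f a a≢b a≢c) ,
  trans (h≗g c (a≢c ∘ sym) (b≢c ∘ sym)) gc ,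
  h≗f
  where
  a≢b : a ≢ b
  a≢b = transfer⇒≢ g→h
  b≢c : b ≢ c
  b≢c = transfer⇒≢ f→g
  h≗f : ∀ x → x ≢ a → x ≢ c → h x ≡ f x
  h≗f x x≢a x≢c with x ≟ᶠ b
  ... | yes refl = trans hb gb
  ... | no x≢b = trans (h≗g x x≢a x≢b) (g≗f x x≢b x≢c)

transfer-out-trans : ∀ {n} {d f g h : Fin n → ℕ} {i j k} → d i < f i → Transfer f i j g →
                     g k < d k → Transfer g j k h → f k < d k × Transfer f i k h
transfer-out-trans {d = d} {i = i} {j} {k} di<fi f→g@(gi , _ , g≗f) gk<dk g→h =
  subst (_< d k) (g≗f k k≢i k≢j) gk<dk , transfer-trans f→g g→h (k≢i ∘ sym)
  where
  k≢j : k ≢ j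
  k≢j = transfer⇒≢ g→h ∘ sym
  k≢i : k ≢ i
  k≢i refl = <⇒≱ gk<dk (≤-pred (subst (d i <_) (sym gi) di<fi))

transfer-in-trans : ∀ {n} {d f g h : Fin n → ℕ} {i j k} → f j < d j → Transfer f i j g →
                    d k < g k → Transfer g k i h → d k < f k × Transfer f k j h
transfer-in-trans {d = d} {i = i} {j} {k} fj<dj f→g@(_ , gj , g≗f) dk<gk g→h =
  subst (d k <_) (g≗f k k≢i k≢j) dk<gk , transfer-trans′ f→g g→h k≢j
  where
  k≢i : k ≢ i
  k≢i = transfer⇒≢ g→h
  k≢j : k ≢ j
  k≢j refl = <⇒≱ fj<dj (≤-pred (subst (d j <_) gj dk<gk))

module SpanningTrees (H : Hypergraph) where

  open Hypergraph H

  infix 4 _⊆ᴱ_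
  infixr 5 _◅◅_

  _⊆ᴱ_ : EdgeSet H → EdgeSet H → Set
  T ⊆ᴱ T′ = ∀ e v → T e v ≡ true → T′ e v ≡ true

  ⊆-trans : ∀ {T T′ T″} → T ⊆ᴱ T′ → T′ ⊆ᴱ T″ → T ⊆ᴱ T″
  ⊆-trans T⊆T′ T′⊆T″ e v = T′⊆T″ e v ∘ T⊆T′ e v

  update : EdgeSet H → Fin nE → Fin nV → Bool → EdgeSet H
  update T j w b e v = if does (e ≟ᶠ j) ∧ does (v ≟ᶠ w) then b else T e v

  remove insert : EdgeSet H → Fin nE → Fin nV → EdgeSet H
  remove T e v = update T e v false
  insert T e v = update T e v true

  exchange : EdgeSet H → Fin nE → Fin nV → Fin nE → Fin nV → EdgeSet H
  exchange T i v j w = insert (remove T i v) j w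

  Elsewhere : Fin nE → Fin nV → Fin nE → Fin nV → Set
  Elsewhere j w e v = e ≢ j ⊎ v ≢ w

  same-point? : ∀ j w e v → (e ≡ j × v ≡ w) ⊎ Elsewhere j w e v
  same-point? j w e v with e ≟ᶠ j | v ≟ᶠ w
  ... | yes e≡j | yes v≡w = inj₁ (e≡j , v≡w)
  ... | no e≢j  | _       = inj₂ (inj₁ e≢j)
  ... | yes _   | no v≢w  = inj₂ (inj₂ v≢w)

  update-same : ∀ T j w b → update T j w b j w ≡ b
  update-same T j w b with j ≟ᶠ j | w ≟ᶠ w
  ... | yes _ | yes _ = refl
  ... | no j≢j | _ = ⊥-elim (j≢j refl)
  ... | yes _ | no w≢w = ⊥-elim (w≢w refl)

  update-other : ∀ T j w b {e v} → Elsewhere j w e v → update T j w b e v ≡ T e v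
  update-other T j w b {e} {v} away with e ≟ᶠ j | v ≟ᶠ w
  ... | no _ | _ = refl
  ... | yes _ | no _ = refl
  update-other T j w b (inj₁ e≢j) | yes e≡j | yes _ = ⊥-elim (e≢j e≡j)
  update-other T j w b (inj₂ v≢w) | yes _ | yes v≡w = ⊥-elim (v≢w v≡w)

  remove-same : ∀ T e v → remove T e v e v ≢ true
  remove-same T e v p with trans (sym (update-same T e v false)) p
  ... | ()

  remove-⊆ : ∀ T e v → remove T e v ⊆ᴱ T
  remove-⊆ T e v e′ v′ p with same-point? e v e′ v′
  ... | inj₁ (refl , refl) = ⊥-elim (remove-same T e v p)
  ... | inj₂ away = trans (sym (update-other T e v false away)) p

  ⊆-insert : ∀ T e v → T ⊆ᴱ insert T e v
  ⊆-insert T e v e′ v′ p with same-point? e v e′ v′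
  ... | inj₁ (refl , refl) = update-same T e v true
  ... | inj₂ away = trans (update-other T e v true away) p

  insert-⊆ : ∀ {T T′ j w} → T ⊆ᴱ T′ → T′ j w ≡ true → insert T j w ⊆ᴱ T′
  insert-⊆ {T} {j = j} {w} T⊆T′ T′jw e v p with same-point? j w e v
  ... | inj₁ (refl , refl) = T′jw
  ... | inj₂ away = T⊆T′ e v (trans (sym (update-other T j w true away)) p)

  ⊆-remove : ∀ {T T′} → T ⊆ᴱ T′ → ∀ {e v} → T e v ≢ true → T ⊆ᴱ remove T′ e v
  ⊆-remove {T} {T′} T⊆T′ {e} {v} ev∉T e′ v′ p with same-point? e v e′ v′
  ... | inj₁ (refl , refl) = ⊥-elim (ev∉T p)
  ... | inj₂ away = trans (update-other T′ e v false away) (T⊆T′ e′ v′ p)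

  remove-mono : ∀ {T T′} → T ⊆ᴱ T′ → ∀ e v → remove T e v ⊆ᴱ remove T′ e v
  remove-mono {T} {T′} T⊆T′ e v e′ v′ p with same-point? e v e′ v′
  ... | inj₁ (refl , refl) = ⊥-elim (remove-same T e v p)
  ... | inj₂ away = trans (update-other T′ e v false away)
                          (T⊆T′ e′ v′ (trans (sym (update-other T e v false away)) p))

  ⊆-insert-remove : ∀ T e v → T ⊆ᴱ insert (remove T e v) e v
  ⊆-insert-remove T e v e′ v′ p with same-point? e v e′ v′
  ... | inj₁ (refl , refl) = update-same (remove T e v) e v true
  ... | inj₂ away = trans (update-other (remove T e v) e v true away)
                          (trans (update-other T e v false away) p)

  remove-insert-⊆ : ∀ G j w e v → remove (insert G j w) e v ⊆ᴱ insert (remove G e v) j w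
  remove-insert-⊆ G j w e v e′ v′ p with same-point? e v e′ v′ | same-point? j w e′ v′
  ... | inj₁ (refl , refl) | _ = ⊥-elim (remove-same (insert G j w) e v p)
  ... | inj₂ _ | inj₁ (refl , refl) = update-same (remove G e v) j w true
  ... | inj₂ away | inj₂ away′ =
    trans (update-other (remove G e v) j w true away′)
      (trans (update-other G e v false away)
        (trans (sym (update-other G j w true away′)) (remove-⊆ (insert G j w) e v e′ v′ p)))

  remove-insert-same : ∀ G j w → remove (insert G j w) j w ⊆ᴱ G
  remove-insert-same G j w e v p with same-point? j w e v
  ... | inj₁ (refl , refl) = ⊥-elim (remove-same (insert G j w) j w p)
  ... | inj₂ away = trans (sym (update-other G j w true away)) (remove-⊆ (insert G j w) j w e v p)

  distinct-points : ∀ {T : EdgeSet H} {i v j w} → T i v ≡ false → T j w ≡ true → Elsewhere i v j w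
  distinct-points {T} {i} {v} {j} {w} iv∉T jw∈T with same-point? i v j w
  ... | inj₂ away = away
  ... | inj₁ (refl , refl) with trans (sym iv∉T) jw∈T
  ...   | ()

  _∩ᴱ_ : EdgeSet H → EdgeSet H → EdgeSet H
  (T ∩ᴱ T′) e v = T e v ∧ T′ e v

  ∩-⊆ˡ : ∀ T T′ → T ∩ᴱ T′ ⊆ᴱ T
  ∩-⊆ˡ T T′ e v p with T e v
  ... | true = refl
  ... | false = p

  ∩-⊆ʳ : ∀ T T′ → T ∩ᴱ T′ ⊆ᴱ T′
  ∩-⊆ʳ T T′ e v p with T e v
  ... | true = p
  ... | false with p
  ...   | ()

  ∩-⊆-removeˡ : ∀ T T′ {e v} → T′ e v ≡ false → T ∩ᴱ T′ ⊆ᴱ remove T e v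
  ∩-⊆-removeˡ T T′ {e} {v} ev∉T′ = ⊆-remove (∩-⊆ˡ T T′) (not-¬ ev∉T′ ∘ ∩-⊆ʳ T T′ e v)

  ∩-⊆-removeʳ : ∀ T T′ {e v} → T e v ≡ false → T ∩ᴱ T′ ⊆ᴱ remove T′ e v
  ∩-⊆-removeʳ T T′ {e} {v} ev∉T = ⊆-remove (∩-⊆ʳ T T′) (not-¬ ev∉T ∘ ∩-⊆ˡ T T′ e v)

  -- Walks in Bip H

  adj-⊆ : ∀ {T T′} → T ⊆ᴱ T′ → ∀ {x y} → Adj H T x y → Adj H T′ x y
  adj-⊆ T⊆T′ {inj₁ v} {inj₂ e} p = T⊆T′ e v p
  adj-⊆ T⊆T′ {inj₂ e} {inj₁ v} p = T⊆T′ e v p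

  walk-⊆ : ∀ {T T′} → T ⊆ᴱ T′ → ∀ {x y} → Walk H T x y → Walk H T′ x y
  walk-⊆ T⊆T′ here = here
  walk-⊆ T⊆T′ (step a π) = step (adj-⊆ T⊆T′ a) (walk-⊆ T⊆T′ π)

  adj-sym : ∀ {T x y} → Adj H T x y → Adj H T y x
  adj-sym {x = inj₁ v} {inj₂ e} p = p
  adj-sym {x = inj₂ e} {inj₁ v} p = p

  _◅◅_ : ∀ {T x y z} → Walk H T x y → Walk H T y z → Walk H T x z
  here ◅◅ ρ = ρ
  step a π ◅◅ ρ = step a (π ◅◅ ρ)

  reverse : ∀ {T x y} → Walk H T x y → Walk H T y x
  reverse here = here
  reverse (step a π) = reverse π ◅◅ step (adj-sym a) here

  IsEdge : Fin nE → Fin nV → Node H → Node H → Set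
  IsEdge e v x y = (x ≡ inj₂ e × y ≡ inj₁ v) ⊎ (x ≡ inj₁ v × y ≡ inj₂ e)

  adj⇒edge : ∀ {T x y} → Adj H T x y → ∃₂ λ e v → T e v ≡ true × IsEdge e v x y
  adj⇒edge {x = inj₁ v} {inj₂ e} a = e , v , a , inj₂ (refl , refl)
  adj⇒edge {x = inj₂ e} {inj₁ v} a = e , v , a , inj₁ (refl , refl)

  edge⇒adj : ∀ {T e v x y} → T e v ≡ true → IsEdge e v x y → Adj H T x y
  edge⇒adj ev (inj₁ (refl , refl)) = ev
  edge⇒adj ev (inj₂ (refl , refl)) = ev

  isEdge-sym : ∀ {e v x y} → IsEdge e v x y → IsEdge e v y x
  isEdge-sym (inj₁ (x≡e , y≡v)) = inj₂ (y≡v , x≡e)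
  isEdge-sym (inj₂ (x≡v , y≡e)) = inj₁ (y≡e , x≡v)

  isEdge-unique : ∀ {e v x y p q} → IsEdge e v x y → IsEdge e v p q → x ≡ p ⊎ (y ≡ p × x ≡ q)
  isEdge-unique (inj₁ (refl , refl)) (inj₁ (refl , refl)) = inj₁ refl
  isEdge-unique (inj₁ (refl , refl)) (inj₂ (refl , refl)) = inj₂ (refl , refl)
  isEdge-unique (inj₂ (refl , refl)) (inj₁ (refl , refl)) = inj₂ (refl , refl)
  isEdge-unique (inj₂ (refl , refl)) (inj₂ (refl , refl)) = inj₁ refl

  edge-endpoints : ∀ {e v x y L} → IsEdge e v x y → x ∈ L → y ∈ L → inj₂ e ∈ L × inj₁ v ∈ L
  edge-endpoints (inj₁ (refl , refl)) x∈L y∈L = x∈L , y∈L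
  edge-endpoints (inj₂ (refl , refl)) x∈L y∈L = y∈L , x∈L

  walk-along-edge : ∀ {T e v x y} → IsEdge e v x y → Walk H T x y → Walk H T (inj₂ e) (inj₁ v)
  walk-along-edge (inj₁ (refl , refl)) π = π
  walk-along-edge (inj₂ (refl , refl)) π = reverse π

  adj-remove : ∀ {T e v x y} → Adj H T x y → ¬ IsEdge e v x y → Adj H (remove T e v) x y
  adj-remove {T} {e} {v} a not-ev with adj⇒edge a
  ... | e′ , v′ , ev′ , isEdge′ with same-point? e v e′ v′
  ...   | inj₁ (refl , refl) = ⊥-elim (not-ev isEdge′)
  ...   | inj₂ away = edge⇒adj (trans (update-other T e v false away) ev′) isEdge′

  WalkVia : EdgeSet H → Fin nE → Fin nV → Node H → Node H → Set
  WalkVia T j w s t = Walk H T s t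
                    ⊎ (Walk H T s (inj₂ j) × Walk H T (inj₁ w) t)
                    ⊎ (Walk H T s (inj₁ w) × Walk H T (inj₂ j) t)

  adj-insert : ∀ {T j w x y} → Adj H (insert T j w) x y →
               Adj H T x y ⊎ (x ≡ inj₂ j × y ≡ inj₁ w) ⊎ (x ≡ inj₁ w × y ≡ inj₂ j)
  adj-insert {T} {j} {w} {inj₁ v} {inj₂ e} p with same-point? j w e v
  ... | inj₁ (refl , refl) = inj₂ (inj₂ (refl , refl))
  ... | inj₂ away = inj₁ (trans (sym (update-other T j w true away)) p)
  adj-insert {T} {j} {w} {inj₂ e} {inj₁ v} p with same-point? j w e v
  ... | inj₁ (refl , refl) = inj₂ (inj₁ (refl , refl))
  ... | inj₂ away = inj₁ (trans (sym (update-other T j w true away)) p)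

  walk-insert-split : ∀ {T T′ j w} → T′ ⊆ᴱ insert T j w →
                      ∀ {s t} → Walk H T′ s t → WalkVia T j w s t
  walk-insert-split sub here = inj₁ here
  walk-insert-split sub (step a π) with adj-insert (adj-⊆ sub a) | walk-insert-split sub π
  ... | inj₁ a′ | inj₁ ρ = inj₁ (step a′ ρ)
  ... | inj₁ a′ | inj₂ (inj₁ (ρ , σ)) = inj₂ (inj₁ (step a′ ρ , σ))
  ... | inj₁ a′ | inj₂ (inj₂ (ρ , σ)) = inj₂ (inj₂ (step a′ ρ , σ))
  ... | inj₂ (inj₁ (refl , refl)) | inj₁ ρ = inj₂ (inj₁ (here , ρ))
  ... | inj₂ (inj₁ (refl , refl)) | inj₂ (inj₁ (_ , σ)) = inj₂ (inj₁ (here , σ))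
  ... | inj₂ (inj₁ (refl , refl)) | inj₂ (inj₂ (_ , σ)) = inj₁ σ
  ... | inj₂ (inj₂ (refl , refl)) | inj₁ ρ = inj₂ (inj₂ (here , ρ))
  ... | inj₂ (inj₂ (refl , refl)) | inj₂ (inj₁ (_ , σ)) = inj₁ σ
  ... | inj₂ (inj₂ (refl , refl)) | inj₂ (inj₂ (_ , σ)) = inj₂ (inj₂ (here , σ))

  _≟ᴺ_ : (x y : Node H) → Dec (x ≡ y)
  _≟ᴺ_ = ≡-dec _≟ᶠ_ _≟ᶠ_

  open DecMembership _≟ᴺ_ using (_∈?_)

  visited : ∀ {T x y} → Walk H T x y → List (Node H)
  visited here = []
  visited (step {y = y} _ π) = y ∷ visited π

  nodes : ∀ {T x y} → Walk H T x y → List (Node H)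
  nodes {x = x} π = x ∷ visited π

  Path : EdgeSet H → Node H → Node H → Set
  Path T x y = Σ (Walk H T x y) (Unique ∘ nodes)

  path-suffix : ∀ {T x y z} (π : Walk H T x y) → Unique (nodes π) → z ∈ nodes π → Path T z y
  path-suffix π u (here refl) = π , u
  path-suffix (step _ π) (_ ∷ u) (there z∈π) = path-suffix π u z∈π

  walk⇒path : ∀ {T x y} → Walk H T x y → Path T x y
  walk⇒path here = here , [] ∷ []
  walk⇒path {x = x} (step a π) with walk⇒path π
  ... | ρ , u with x ∈? nodes ρ
  ...   | yes x∈ρ = path-suffix ρ u x∈ρ
  ...   | no x∉ρ = step a ρ , ¬Any⇒All¬ _ x∉ρ ∷ u

  -- Forests and spanning trees

  Forest : EdgeSet H → Set
  Forest T = ∀ e v → T e v ≡ true → ¬ Walk H (remove T e v) (inj₂ e) (inj₁ v)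

  linked-closing : ∀ {G T x y z} (π : Walk H G x y) → G ⊆ᴱ T → Adj H T y z →
                   Linked (Adj H T) (nodes π ++ [ z ])
  linked-closing here G⊆T a = a ∷ [-]
  linked-closing (step a π) G⊆T a′ = adj-⊆ G⊆T a ∷ linked-closing π G⊆T a′

  acyclic⇒forest : ∀ {T} → ¬ HasCycle H T → Forest T
  acyclic⇒forest {T} acyclic e v Tev π = no-path (walk⇒path π)
    where
    no-path : Path (remove T e v) (inj₂ e) (inj₁ v) → ⊥
    no-path (step a here , _) = remove-same T e v a
    no-path (π@(step {y = y} _ (step {y = y′} _ ρ)) , u) =
      acyclic (inj₂ e , y ∷ y′ ∷ visited ρ , s≤s (s≤s z≤n) , u , linked-closing π (remove-⊆ T e v) Tev)

  forest⇒acyclic : ∀ {T} → Forest T → ¬ HasCycle H T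
  forest⇒acyclic F (x , y ∷ [] , s≤s () , _)
  forest⇒acyclic {T} F (x , y ∷ ys@(_ ∷ _) , _ , (x≢ ∷ y≢ ∷ _) , (a ∷ chain)) with adj⇒edge a
  ... | e , v , ev , xy = F e v ev (walk-along-edge (isEdge-sym xy) (around y ys chain x≢ y≢ (inj₂ λ ())))
    where
    other-edge : ∀ {p q} → x ≢ p → y ≢ p ⊎ x ≢ q → ¬ IsEdge e v p q
    other-edge x≢p y≢p⊎x≢q pq with isEdge-unique xy pq | y≢p⊎x≢q
    ... | inj₁ x≡p | _ = x≢p x≡p
    ... | inj₂ (y≡p , _) | inj₁ y≢p = y≢p y≡p
    ... | inj₂ (_ , x≡q) | inj₂ x≢q = x≢q x≡q
    -- The final step into x does not start at y, since the cycle has at least three nodes.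
    around : ∀ p L → Linked (Adj H T) (p ∷ L ++ [ x ]) → All (x ≢_) (p ∷ L) → All (y ≢_) L →
             y ≢ p ⊎ L ≢ [] → Walk H (remove T e v) p x
    around p [] (a′ ∷ [-]) (x≢p ∷ []) [] (inj₁ y≢p) = step (adj-remove a′ (other-edge x≢p (inj₁ y≢p))) here
    around p [] _ _ _ (inj₂ []≢[]) = ⊥-elim ([]≢[] refl)
    around p (q ∷ L) (a′ ∷ l) (x≢p ∷ x≢q ∷ x≢L) (y≢q ∷ y≢L) _ =
      step (adj-remove a′ (other-edge x≢p (inj₂ x≢q))) (around q L l (x≢q ∷ x≢L) y≢L (inj₁ y≢q))

  forest-⊆ : ∀ {T T′} → T′ ⊆ᴱ T → Forest T → Forest T′
  forest-⊆ T′⊆T F e v T′ev π = F e v (T′⊆T e v T′ev) (walk-⊆ (remove-mono T′⊆T e v) π)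

  forest-insert : ∀ {G j w} → Forest G → ¬ Walk H G (inj₂ j) (inj₁ w) → Forest (insert G j w)
  forest-insert {G} {j} {w} F j↮w e v ev π with same-point? j w e v
  ... | inj₁ (refl , refl) = j↮w (walk-⊆ (remove-insert-same G j w) π)
  ... | inj₂ away = via-edge (walk-insert-split (remove-insert-⊆ G j w e v) π)
    where
    Gev : G e v ≡ true
    Gev = trans (sym (update-other G j w true away)) ev
    lift : ∀ {x y} → Walk H (remove G e v) x y → Walk H G x y
    lift = walk-⊆ (remove-⊆ G e v)
    via-edge : WalkVia (remove G e v) j w (inj₂ e) (inj₁ v) → ⊥
    via-edge (inj₁ ρ) = F e v Gev ρ
    via-edge (inj₂ (inj₁ (ρ , σ))) = j↮w (reverse (lift ρ) ◅◅ step Gev (reverse (lift σ)))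
    via-edge (inj₂ (inj₂ (ρ , σ))) = j↮w (lift σ ◅◅ step Gev (lift ρ))

  removal-sides : ∀ {T} → GConnected H T → ∀ i v z →
                  Walk H (remove T i v) z (inj₂ i) ⊎ Walk H (remove T i v) z (inj₁ v)
  removal-sides {T} connected i v z with walk-insert-split (⊆-insert-remove T i v) (connected z (inj₂ i))
  ... | inj₁ ρ = inj₁ ρ
  ... | inj₂ (inj₁ (ρ , _)) = inj₁ ρ
  ... | inj₂ (inj₂ (ρ , _)) = inj₂ ρ

  separated⇒absent : ∀ {T : EdgeSet H} {i v j w} → Elsewhere i v j w →
                     ¬ Walk H (remove T i v) (inj₂ j) (inj₁ w) → T j w ≡ false
  separated⇒absent {T} {i} {v} {j} {w} away j↮w =
    ¬-not λ jw∈T → j↮w (step (trans (update-other T i v false away) jw∈T) here)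

  exchange-spanningTree : ∀ {T} i v j w → SpanningTree H T → inc j w ≡ true →
                          ¬ Walk H (remove T i v) (inj₂ j) (inj₁ w) →
                          SpanningTree H (exchange T i v j w)
  exchange-spanningTree {T} i v j w (T⊆inc , connected , acyclic) jw j↮w =
    insert-⊆ (⊆-trans (remove-⊆ T i v) T⊆inc) jw ,
    (λ x y → to-i x ◅◅ reverse (to-i y)) ,
    forest⇒acyclic (forest-insert (forest-⊆ (remove-⊆ T i v) (acyclic⇒forest acyclic)) j↮w)
    where
    lift : ∀ {x y} → Walk H (remove T i v) x y → Walk H (exchange T i v j w) x y
    lift = walk-⊆ (⊆-insert (remove T i v) j w)
    new-edge : Adj H (exchange T i v j w) (inj₂ j) (inj₁ w)
    new-edge = update-same (remove T i v) j w true
    reconnect : Walk H (exchange T i v j w) (inj₂ i) (inj₁ v)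
    reconnect with removal-sides connected i v (inj₂ j) | removal-sides connected i v (inj₁ w)
    ... | inj₁ ρ | inj₁ σ = ⊥-elim (j↮w (ρ ◅◅ reverse σ))
    ... | inj₂ ρ | inj₂ σ = ⊥-elim (j↮w (ρ ◅◅ reverse σ))
    ... | inj₁ ρ | inj₂ σ = reverse (lift ρ) ◅◅ step new-edge (lift σ)
    ... | inj₂ ρ | inj₁ σ = reverse (lift σ) ◅◅ step new-edge (lift ρ)
    to-i : ∀ z → Walk H (exchange T i v j w) z (inj₂ i)
    to-i z with removal-sides connected i v z
    ... | inj₁ ρ = lift ρ
    ... | inj₂ ρ = lift ρ ◅◅ reverse reconnect

  record ExchangePair (T₁ T₂ : EdgeSet H) (i : Fin nE) (v : Fin nV) (j : Fin nE) (w : Fin nV) : Set where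
    field
      old∈T₁ : T₁ i v ≡ true
      old∉T₂ : T₂ i v ≡ false
      new∈T₂ : T₂ j w ≡ true
      new∉T₁ : T₁ j w ≡ false
      separates : ¬ Walk H (remove T₁ i v) (inj₂ j) (inj₁ w)

  fundamental-cut : ∀ {T₁ T₂ i v} → SpanningTree H T₁ → SpanningTree H T₂ →
                    T₁ i v ≡ true → T₂ i v ≡ false → ∃₂ λ j w → ExchangePair T₁ T₂ i v j w
  fundamental-cut {T₁} {T₂} {i} {v} (_ , connected₁ , acyclic₁) (_ , connected₂ , _) iv∈T₁ iv∉T₂ =
    crossing (connected₂ (inj₂ i) (inj₁ v)) here here
    where
    G : EdgeSet H
    G = remove T₁ i v
    split : ∀ {z} → Walk H G z (inj₂ i) → Walk H G z (inj₁ v) → ⊥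
    split ρ σ = acyclic⇒forest acyclic₁ i v iv∈T₁ (reverse ρ ◅◅ σ)
    pair : ∀ j w → T₂ j w ≡ true → ¬ Walk H G (inj₂ j) (inj₁ w) → ∃₂ λ j w → ExchangePair T₁ T₂ i v j w
    pair j w jw∈T₂ j↮w = j , w , record
      { old∈T₁ = iv∈T₁ ; old∉T₂ = iv∉T₂ ; new∈T₂ = jw∈T₂
      ; new∉T₁ = separated⇒absent (distinct-points {T₂} iv∉T₂ jw∈T₂) j↮w ; separates = j↮w }
    bridge : ∀ {p q} → Adj H T₂ p q → Walk H G p (inj₂ i) → Walk H G q (inj₁ v) →
             ∃₂ λ j w → ExchangePair T₁ T₂ i v j w
    bridge {inj₂ j} {inj₁ w} jw ρ σ = pair j w jw λ π → split (reverse π ◅◅ ρ) σ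
    bridge {inj₁ w} {inj₂ j} jw ρ σ = pair j w jw λ π → split (π ◅◅ ρ) σ
    crossing : ∀ {s t} → Walk H T₂ s t → Walk H G s (inj₂ i) → Walk H G t (inj₁ v) →
               ∃₂ λ j w → ExchangePair T₁ T₂ i v j w
    crossing here ρ σ = ⊥-elim (split ρ σ)
    crossing (step {y = y} a π) ρ σ with removal-sides connected₁ i v y
    ... | inj₁ ρ′ = crossing π ρ′ σ
    ... | inj₂ σ′ = bridge a ρ σ′

  fundamental-cycle : ∀ {T₁ T₂ j w} → SpanningTree H T₁ → SpanningTree H T₂ →
                      T₂ j w ≡ true → T₁ j w ≡ false → ∃₂ λ i v → ExchangePair T₁ T₂ i v j w
  fundamental-cycle {T₁} {T₂} {j} {w} (_ , connected₁ , acyclic₁) (_ , _ , acyclic₂) jw∈T₂ jw∉T₁ =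
    conclude (along (proj₁ path) (proj₂ path))
    where
    path : Path T₁ (inj₂ j) (inj₁ w)
    path = walk⇒path (connected₁ (inj₂ j) (inj₁ w))
    Separator : ∀ {s t} → Walk H T₁ s t → Set
    Separator {s} {t} π = ∃₂ λ i v → T₁ i v ≡ true × T₂ i v ≡ false
                        × (inj₂ i ∈ nodes π × inj₁ v ∈ nodes π) × ¬ Walk H (remove T₁ i v) s t
    -- The last edge of the path outside T₂ separates its ends; as the path is simple, no earlier
    -- step is that edge.
    along : ∀ {s t} (π : Walk H T₁ s t) → Unique (nodes π) → Separator π ⊎ Walk H (T₁ ∩ᴱ T₂) s t
    along here _ = inj₂ here
    along {s} (step {y = y} a π) (s∉π ∷ u) with adj⇒edge a | along π u
    ... | _ | inj₁ (i , v , iv∈T₁ , iv∉T₂ , (i∈π , v∈π) , y↮t) =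
      inj₁ (i , v , iv∈T₁ , iv∉T₂ , (there i∈π , there v∈π) ,
            λ ρ → y↮t (step (adj-sym (adj-remove a not-iv)) ρ))
      where
      not-iv : ¬ IsEdge i v s y
      not-iv (inj₁ (s≡i , _)) = All¬⇒¬Any s∉π (subst (_∈ nodes π) (sym s≡i) i∈π)
      not-iv (inj₂ (s≡v , _)) = All¬⇒¬Any s∉π (subst (_∈ nodes π) (sym s≡v) v∈π)
    ... | e , x , ex∈T₁ , sy | inj₂ common with T₂ e x in ex∈?T₂
    ...   | true = inj₂ (step (edge⇒adj (cong₂ _∧_ ex∈T₁ ex∈?T₂) sy) common)
    ...   | false = inj₁ (e , x , ex∈T₁ , ex∈?T₂ , edge-endpoints sy (here refl) (there (here refl)) , λ ρ →
              acyclic⇒forest acyclic₁ e x ex∈T₁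
                (walk-along-edge sy (ρ ◅◅ reverse (walk-⊆ (∩-⊆-removeˡ T₁ T₂ ex∈?T₂) common))))
    conclude : Separator (proj₁ path) ⊎ Walk H (T₁ ∩ᴱ T₂) (inj₂ j) (inj₁ w) →
               ∃₂ λ i v → ExchangePair T₁ T₂ i v j w
    conclude (inj₁ (i , v , iv∈T₁ , iv∉T₂ , _ , j↮w)) =
      i , v , record { old∈T₁ = iv∈T₁ ; old∉T₂ = iv∉T₂ ; new∈T₂ = jw∈T₂ ; new∉T₁ = jw∉T₁ ; separates = j↮w }
    conclude (inj₂ common) =
      ⊥-elim (acyclic⇒forest acyclic₂ j w jw∈T₂ (walk-⊆ (∩-⊆-removeʳ T₁ T₂ jw∉T₁) common))

  -- Degrees

  indicator : Bool → ℕ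
  indicator b = if b then 1 else 0

  deg≡sum : ∀ T e → deg H T e ≡ sum (λ v → indicator (T e v))
  deg≡sum T e = sum-allFin nV (λ v → indicator (T e v))

  deg-cong : ∀ T T′ e → (∀ v → T e v ≡ T′ e v) → deg H T e ≡ deg H T′ e
  deg-cong T T′ e T≗T′ = begin
    deg H T e                         ≡⟨ deg≡sum T e ⟩
    sum (λ v → indicator (T e v))     ≡⟨ sum-cong-≗ (cong indicator ∘ T≗T′) ⟩
    sum (λ v → indicator (T′ e v))    ≡⟨ deg≡sum T′ e ⟨
    deg H T′ e                        ∎

  deg-suc : ∀ T T′ e w → (∀ v → v ≢ w → T′ e v ≡ T e v) → T′ e w ≡ true → T e w ≡ false →
            deg H T′ e ≡ suc (deg H T e)
  deg-suc T T′ e w same new old = begin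
    deg H T′ e                             ≡⟨ deg≡sum T′ e ⟩
    sum (λ v → indicator (T′ e v))         ≡⟨ sum-suc-at w (λ v v≢w → cong indicator (same v v≢w)) at-w ⟩
    suc (sum (λ v → indicator (T e v)))    ≡⟨ cong suc (deg≡sum T e) ⟨
    suc (deg H T e)                        ∎
    where
    at-w : indicator (T′ e w) ≡ suc (indicator (T e w))
    at-w rewrite new | old = refl

  deg-update-other : ∀ T e v b {k} → k ≢ e → deg H (update T e v b) k ≡ deg H T k
  deg-update-other T e v b {k} k≢e = deg-cong (update T e v b) T k λ _ → update-other T e v b (inj₁ k≢e)

  deg-remove : ∀ T e v → T e v ≡ true → deg H T e ≡ suc (deg H (remove T e v) e)
  deg-remove T e v ev∈T =
    deg-suc (remove T e v) T e v (λ v′ v′≢v → sym (update-other T e v false (inj₂ v′≢v)))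
            ev∈T (update-same T e v false)

  deg-insert : ∀ T e v → T e v ≡ false → deg H (insert T e v) e ≡ suc (deg H T e)
  deg-insert T e v ev∉T =
    deg-suc T (insert T e v) e v (λ v′ v′≢v → update-other T e v true (inj₂ v′≢v))
            (update-same T e v true) ev∉T

  deg-exchange : ∀ {T i v j w} → T i v ≡ true → T j w ≡ false → i ≢ j →
                 Transfer (deg H T) i j (deg H (exchange T i v j w))
  deg-exchange {T} {i} {v} {j} {w} iv∈T jw∉T i≢j =
    trans (cong suc (deg-update-other (remove T i v) j w true i≢j)) (sym (deg-remove T i v iv∈T)) ,
    trans (deg-insert (remove T i v) j w (trans (update-other T i v false (inj₁ (i≢j ∘ sym))) jw∉T))
          (cong suc (deg-update-other T i v false (i≢j ∘ sym))) ,
    λ k k≢i k≢j → trans (deg-update-other (remove T i v) j w true k≢j) (deg-update-other T i v false k≢i)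

  deg-exchange-same : ∀ {T i v w} → T i v ≡ true → T i w ≡ false →
                      deg H (exchange T i v i w) ≗ deg H T
  deg-exchange-same {T} {i} {v} {w} iv∈T iw∉T k = by-cases k (k ≟ᶠ i)
    where
    w≢v : w ≢ v
    w≢v refl with trans (sym iv∈T) iw∉T
    ... | ()
    by-cases : ∀ k → Dec (k ≡ i) → deg H (exchange T i v i w) k ≡ deg H T k
    by-cases k (no k≢i) =
      trans (deg-update-other (remove T i v) i w true k≢i) (deg-update-other T i v false k≢i)
    by-cases k (yes refl) =
      trans (deg-insert (remove T i v) i w (trans (update-other T i v false (inj₂ w≢v)) iw∉T))
            (sym (deg-remove T i v iv∈T))

  deg<⇒edge : ∀ T T′ e → deg H T e < deg H T′ e → ∃ λ v → T e v ≡ false × T′ e v ≡ true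
  deg<⇒edge T T′ e lt with sum<⇒∃< (subst₂ _<_ (deg≡sum T e) (deg≡sum T′ e) lt)
  ... | v , indicator< = v , indicators indicator<
    where
    indicators : indicator (T e v) < indicator (T′ e v) → T e v ≡ false × T′ e v ≡ true
    indicators lt′ with T e v | T′ e v
    indicators _ | false | true = refl , refl
    indicators (s≤s ()) | true | true
    indicators () | true | false
    indicators () | false | false

  -- The exchange property

  missing : Bool → Bool → ℕ
  missing true false = 1
  missing _ _ = 0

  ∣_∖_∣ : EdgeSet H → EdgeSet H → ℕ
  ∣ T₂ ∖ T ∣ = sum λ e → sum λ v → missing (T₂ e v) (T e v)

  exchange-shrinks : ∀ {T₁ T₂ i v j w} → ExchangePair T₁ T₂ i v j w →
                     ∣ T₂ ∖ T₁ ∣ ≡ suc ∣ T₂ ∖ exchange T₁ i v j w ∣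
  exchange-shrinks {T₁} {T₂} {i} {v} {j} {w} pair =
    sum-suc-at j (λ e e≢j → sum-cong-≗ λ x → unchanged e x (inj₁ e≢j))
                 (sum-suc-at w (λ x x≢w → unchanged j x (inj₂ x≢w)) at-jw)
    where
    open ExchangePair pair
    unchanged : ∀ e x → Elsewhere j w e x →
                missing (T₂ e x) (T₁ e x) ≡ missing (T₂ e x) (exchange T₁ i v j w e x)
    unchanged e x away with same-point? i v e x
    ... | inj₁ (refl , refl) rewrite old∉T₂ = refl
    ... | inj₂ away′ = cong (missing (T₂ e x))
      (sym (trans (update-other (remove T₁ i v) j w true away) (update-other T₁ i v false away′)))
    at-jw : missing (T₂ j w) (T₁ j w) ≡ suc (missing (T₂ j w) (exchange T₁ i v j w j w))
    at-jw = trans (cong₂ missing new∈T₂ new∉T₁)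
                  (cong suc (sym (cong₂ missing new∈T₂ (update-same (remove T₁ i v) j w true))))

  Exchange : EdgeSet H → Fin nE → Fin nE → Set
  Exchange T₁ i j = Σ (EdgeSet H) λ T → SpanningTree H T × Transfer (deg H T₁) i j (deg H T)

  Improvement : EdgeSet H → EdgeSet H → Fin nE → Fin nE → Set
  Improvement T₁ T₂ i j = Σ (EdgeSet H) λ T → SpanningTree H T × ∣ T₂ ∖ T ∣ < ∣ T₂ ∖ T₁ ∣
                        × ((i ≡ j × deg H T ≗ deg H T₁) ⊎ Transfer (deg H T₁) i j (deg H T))

  exchange-step : ∀ {T₁ T₂ i v j w} → SpanningTree H T₁ → SpanningTree H T₂ →
                  ExchangePair T₁ T₂ i v j w → Improvement T₁ T₂ i j
  exchange-step {T₁} {T₂} {i} {v} {j} {w} st₁ (T₂⊆inc , _) pair =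
    exchange T₁ i v j w ,
    exchange-spanningTree i v j w st₁ (T₂⊆inc j w new∈T₂) separates ,
    ≤-reflexive (sym (exchange-shrinks pair)) ,
    degrees (i ≟ᶠ j)
    where
    open ExchangePair pair
    degrees : Dec (i ≡ j) → (i ≡ j × deg H (exchange T₁ i v j w) ≗ deg H T₁)
                          ⊎ Transfer (deg H T₁) i j (deg H (exchange T₁ i v j w))
    degrees (yes refl) = inj₁ (refl , deg-exchange-same old∈T₁ new∉T₁)
    degrees (no i≢j) = inj₂ (deg-exchange old∈T₁ new∉T₁ i≢j)

  module _ {T₂} (st₂ : SpanningTree H T₂) where

    exchange-out : ∀ {T₁ i} → SpanningTree H T₁ → deg H T₂ i < deg H T₁ i →
                   ∃ λ j → deg H T₁ j < deg H T₂ j × Exchange T₁ i j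
    exchange-out st₁ = go (<-wellFounded _) st₁
      where
      -- Swap a T₁-edge at i outside T₂ for a T₂-edge (j, w) across its fundamental cut. If j
      -- lacks valence with respect to T₂ we are done, otherwise the surplus is passed on from j.
      go : ∀ {T₁ i} → Acc _<_ ∣ T₂ ∖ T₁ ∣ → SpanningTree H T₁ → deg H T₂ i < deg H T₁ i →
           ∃ λ j → deg H T₁ j < deg H T₂ j × Exchange T₁ i j
      go {T₁} {i} (acc smaller) st₁ lt with deg<⇒edge T₂ T₁ i lt
      ... | v , iv∉T₂ , iv∈T₁ with fundamental-cut st₁ st₂ iv∈T₁ iv∉T₂
      ... | j , w , pair with exchange-step st₁ st₂ pair
      ... | T′ , st′ , shrink , inj₁ (refl , same)
            with go (smaller shrink) st′ (subst (deg H T₂ i <_) (sym (same i)) lt)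
      ...   | k , lt′ , T , st , T′→T =
              k , subst (_< deg H T₂ k) (same k) lt′ , T , st , transfer-congˡ same T′→T
      go {T₁} {i} (acc smaller) st₁ lt | v , _ | j , w , _ | T′ , st′ , shrink , inj₂ T₁→T′@(_ , T′j , _)
            with deg H T₁ j <? deg H T₂ j
      ...   | yes done = j , done , T′ , st′ , T₁→T′
      ...   | no ¬done with go (smaller shrink) st′ (subst (deg H T₂ j <_) (sym T′j) (s≤s (≮⇒≥ ¬done)))
      ...     | k , lt′ , T , st , T′→T with transfer-out-trans lt T₁→T′ lt′ T′→T
      ...       | lt″ , T₁→T = k , lt″ , T , st , T₁→T

    exchange-in : ∀ {T₁ j} → SpanningTree H T₁ → deg H T₁ j < deg H T₂ j →
                  ∃ λ i → deg H T₂ i < deg H T₁ i × Exchange T₁ i j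
    exchange-in st₁ = go (<-wellFounded _) st₁
      where
      -- Dually, bring a T₂-edge (j, w) into T₁ by removing an edge i of its fundamental cycle.
      go : ∀ {T₁ j} → Acc _<_ ∣ T₂ ∖ T₁ ∣ → SpanningTree H T₁ → deg H T₁ j < deg H T₂ j →
           ∃ λ i → deg H T₂ i < deg H T₁ i × Exchange T₁ i j
      go {T₁} {j} (acc smaller) st₁ lt with deg<⇒edge T₁ T₂ j lt
      ... | w , jw∉T₁ , jw∈T₂ with fundamental-cycle st₁ st₂ jw∈T₂ jw∉T₁
      ... | i , v , pair with exchange-step st₁ st₂ pair
      ... | T′ , st′ , shrink , inj₁ (refl , same)
            with go (smaller shrink) st′ (subst (_< deg H T₂ j) (sym (same j)) lt)
      ...   | k , lt′ , T , st , T′→T =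
              k , subst (deg H T₂ k <_) (same k) lt′ , T , st , transfer-congˡ same T′→T
      go {T₁} {j} (acc smaller) st₁ lt | w , _ | i , v , _ | T′ , st′ , shrink , inj₂ T₁→T′@(T′i , _)
            with deg H T₂ i <? deg H T₁ i
      ...   | yes done = i , done , T′ , st′ , T₁→T′
      ...   | no ¬done with go (smaller shrink) st′ (subst (_≤ deg H T₂ i) (sym T′i) (≮⇒≥ ¬done))
      ...     | k , lt′ , T , st , T′→T with transfer-in-trans lt T₁→T′ lt′ T′→T
      ...       | lt″ , T₁→T = k , lt″ , T , st , T₁→T

  -- Hypertrees

  exchange⇒canTransfer : ∀ {f T₁ a b} → (∀ e → deg H T₁ e ≡ suc (f e)) → 0 < f a →
                         Exchange T₁ a b → CanTransfer H f a b
  exchange⇒canTransfer {f} {T₁} {a} {b} deg₁ 0<fa (T , st , Ta , Tb , T≗T₁) =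
    pred ∘ deg H T ,
    trans (cong (λ (n : ℕ) → suc (pred n)) Ta≡fa) (suc-pred (f a) {{>-nonZero 0<fa}}) ,
    cong pred Tb≡ ,
    (λ x x≢a x≢b → cong pred (trans (T≗T₁ x x≢a x≢b) (deg₁ x))) ,
    T , st , λ e → sym (suc-pred (deg H T e) {{>-nonZero (positive e)}})
    where
    Ta≡fa : deg H T a ≡ f a
    Ta≡fa = suc-injective (trans Ta (deg₁ a))
    Tb≡ : deg H T b ≡ suc (suc (f b))
    Tb≡ = trans Tb (cong suc (deg₁ b))
    -- pred loses nothing: all degrees of T are positive.
    positive : ∀ e → 0 < deg H T e
    positive e with e ≟ᶠ a | e ≟ᶠ b
    ... | yes refl | _ = subst (0 <_) (sym Ta≡fa) 0<fa
    ... | no _ | yes refl = subst (0 <_) (sym Tb≡) z<s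
    ... | no e≢a | no e≢b = subst (0 <_) (sym (trans (T≗T₁ e e≢a e≢b) (deg₁ e))) z<s

  hypertree-transfer-out : ∀ {f g a} → IsHypertree H f → IsHypertree H g → g a < f a →
                           ∃ λ b → f b < g b × CanTransfer H f a b
  hypertree-transfer-out {f} {g} {a} (T₁ , st₁ , deg₁) (T₂ , st₂ , deg₂) ga<fa =
    conclude (exchange-out {T₂} st₂ {T₁} {a} st₁ (subst₂ _<_ (sym (deg₂ a)) (sym (deg₁ a)) (s≤s ga<fa)))
    where
    conclude : (∃ λ b → deg H T₁ b < deg H T₂ b × Exchange T₁ a b) → ∃ λ b → f b < g b × CanTransfer H f a b
    conclude (b , lt , ex) =
      b , ≤-pred (subst₂ _<_ (deg₁ b) (deg₂ b) lt) ,
      exchange⇒canTransfer {f} {T₁} {a} {b} deg₁ (<-≤-trans z<s ga<fa) ex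

  hypertree-transfer-in : ∀ {f g b} → IsHypertree H f → IsHypertree H g → f b < g b →
                          ∃ λ a → g a < f a × CanTransfer H f a b
  hypertree-transfer-in {f} {g} {b} (T₁ , st₁ , deg₁) (T₂ , st₂ , deg₂) fb<gb =
    conclude (exchange-in {T₂} st₂ {T₁} {b} st₁ (subst₂ _<_ (sym (deg₁ b)) (sym (deg₂ b)) (s≤s fb<gb)))
    where
    conclude : (∃ λ a → deg H T₂ a < deg H T₁ a × Exchange T₁ a b) → ∃ λ a → g a < f a × CanTransfer H f a b
    conclude (a , lt , ex) =
      a , ga<fa , exchange⇒canTransfer {f} {T₁} {a} {b} deg₁ (<-≤-trans z<s ga<fa) ex
      where
      ga<fa : g a < f a
      ga<fa = ≤-pred (subst₂ _<_ (deg₂ a) (deg₁ a) lt)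

  hypertree-trade-off : ∀ {f₁ f₂ a b} → IsHypertree H f₁ → IsHypertree H f₂ → f₁ a < f₂ a →
                        (∀ c → c ≢ a → c ≢ b → f₁ c ≡ f₂ c) → f₂ b < f₁ b
  hypertree-trade-off {f₁} {f₂} {a} {b} h₁ h₂ f₁a<f₂a agree =
    conclude (hypertree-transfer-in {f₁} {f₂} {a} h₁ h₂ f₁a<f₂a)
    where
    at : ∀ c → f₂ c < f₁ c → Dec (c ≡ b) → Dec (c ≡ a) → f₂ b < f₁ b
    at c lt (yes refl) _ = lt
    at c lt (no _) (yes refl) = ⊥-elim (<-asym lt f₁a<f₂a)
    at c lt (no c≢b) (no c≢a) = ⊥-elim (<-irrefl (sym (agree c c≢a c≢b)) lt)
    conclude : (∃ λ c → f₂ c < f₁ c × CanTransfer H f₁ c a) → f₂ b < f₁ b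
    conclude (c , lt , _) = at c lt (c ≟ᶠ b) (c ≟ᶠ a)

  ¬canTransfer-into : ∀ {f₁ f₂ a b d} → IsHypertree H f₁ → IsHypertree H f₂ → f₁ b ≤ f₂ b →
                      (∀ {c} → f₂ c < f₁ c → c ≡ d) →
                      ¬ CanTransfer H f₁ a b → ¬ CanTransfer H f₁ d b → ¬ CanTransfer H f₂ a b
  ¬canTransfer-into {f₁} {f₂} {a} {b} {d} h₁ h₂ f₁b≤f₂b only-d ¬a→b ¬d→b (g , _ , gb , g≗f₂ , hg) =
    conclude (hypertree-transfer-in {f₁} {g} {b} h₁ hg f₁b<gb)
    where
    f₁b<gb : f₁ b < g b
    f₁b<gb = subst (f₁ b <_) (sym gb) (s≤s f₁b≤f₂b)
    at : ∀ c → g c < f₁ c → CanTransfer H f₁ c b → Dec (c ≡ a) → Dec (c ≡ b) → ⊥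
    at c _ c→b (yes refl) _ = ¬a→b c→b
    at c gc<f₁c _ (no _) (yes refl) = <-asym gc<f₁c f₁b<gb
    at c gc<f₁c c→b (no c≢a) (no c≢b) =
      ¬d→b (subst (λ c → CanTransfer H f₁ c b) (only-d (subst (_< f₁ c) (g≗f₂ c c≢a c≢b) gc<f₁c)) c→b)
    conclude : ¬ (∃ λ c → g c < f₁ c × CanTransfer H f₁ c b)
    conclude (c , gc<f₁c , c→b) = at c gc<f₁c c→b (c ≟ᶠ a) (c ≟ᶠ b)

  ¬canTransfer-from : ∀ {f₁ f₂ a b d} → IsHypertree H f₁ → IsHypertree H f₂ → f₂ a ≤ f₁ a →
                      (∀ {c} → f₁ c < f₂ c → c ≡ d) →
                      ¬ CanTransfer H f₁ a b → ¬ CanTransfer H f₁ a d → ¬ CanTransfer H f₂ a b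
  ¬canTransfer-from {f₁} {f₂} {a} {b} {d} h₁ h₂ f₂a≤f₁a only-d ¬a→b ¬a→d (g , ga , _ , g≗f₂ , hg) =
    conclude (hypertree-transfer-out {f₁} {g} {a} h₁ hg ga<f₁a)
    where
    ga<f₁a : g a < f₁ a
    ga<f₁a = subst (_≤ f₁ a) (sym ga) f₂a≤f₁a
    at : ∀ c → f₁ c < g c → CanTransfer H f₁ a c → Dec (c ≡ b) → Dec (c ≡ a) → ⊥
    at c _ a→c (yes refl) _ = ¬a→b a→c
    at c f₁c<gc _ (no _) (yes refl) = <-asym f₁c<gc ga<f₁a
    at c f₁c<gc a→c (no c≢b) (no c≢a) =
      ¬a→d (subst (CanTransfer H f₁ a) (only-d (subst (f₁ c <_) (g≗f₂ c c≢a c≢b) f₁c<gc)) a→c)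
    conclude : ¬ (∃ λ c → f₁ c < g c × CanTransfer H f₁ a c)
    conclude (c , f₁c<gc , a→c) = at c f₁c<gc a→c (c ≟ᶠ b) (c ≟ᶠ a)

open Hypergraph

lemma8 : (H : Hypergraph) → Connected H →
    (e₁ e₂ : Fin (nE H)) → e₁ ≢ e₂ →
    (f₁ f₂ : Fin (nE H) → ℕ) → IsHypertree H f₁ → IsHypertree H f₂ →
    f₁ e₁ < f₂ e₁ →
    (∀ e → e ≢ e₁ → e ≢ e₂ → f₁ e ≡ f₂ e) →
    (e e′ : Fin (nE H)) → e ≢ e′ →
    e ≢ e₁ → e ≢ e₂ → e′ ≢ e₁ → e′ ≢ e₂ →
    ((¬ CanTransfer H f₁ e e′ × ¬ CanTransfer H f₁ e₂ e′) →
       (¬ CanTransfer H f₂ e e′ × ¬ CanTransfer H f₂ e₂ e′))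
    × ((¬ CanTransfer H f₁ e e₁ × ¬ CanTransfer H f₁ e e′) →
       (¬ CanTransfer H f₂ e e₁ × ¬ CanTransfer H f₂ e e′))
lemma8 H _ e₁ e₂ _ f₁ f₂ h₁ h₂ f₁e₁<f₂e₁ agree e e′ _ e≢e₁ e≢e₂ e′≢e₁ e′≢e₂ =
  (λ (¬e→e′ , ¬e₂→e′) → into-e′ {e} ¬e→e′ ¬e₂→e′ , into-e′ {e₂} ¬e₂→e′ ¬e₂→e′) ,
  (λ (¬e→e₁ , ¬e→e′) → from-e {e₁} ¬e→e₁ ¬e→e₁ , from-e {e′} ¬e→e′ ¬e→e₁)
  where
  open SpanningTrees H
  only-e₂ : ∀ {c} → f₂ c < f₁ c → c ≡ e₂
  only-e₂ {c} lt with c ≟ᶠ e₂ | c ≟ᶠ e₁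
  ... | yes c≡e₂ | _ = c≡e₂
  ... | no _ | yes refl = ⊥-elim (<-asym lt f₁e₁<f₂e₁)
  ... | no c≢e₂ | no c≢e₁ = ⊥-elim (<-irrefl (sym (agree c c≢e₁ c≢e₂)) lt)
  only-e₁ : ∀ {c} → f₁ c < f₂ c → c ≡ e₁
  only-e₁ {c} lt with c ≟ᶠ e₁ | c ≟ᶠ e₂
  ... | yes c≡e₁ | _ = c≡e₁
  ... | no _ | yes refl = ⊥-elim (<-asym lt (hypertree-trade-off {f₁} {f₂} {e₁} {e₂} h₁ h₂ f₁e₁<f₂e₁ agree))
  ... | no c≢e₁ | no c≢e₂ = ⊥-elim (<-irrefl (agree c c≢e₁ c≢e₂) lt)
  into-e′ : ∀ {a} → ¬ CanTransfer H f₁ a e′ → ¬ CanTransfer H f₁ e₂ e′ → ¬ CanTransfer H f₂ a e′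
  into-e′ {a} =
    ¬canTransfer-into {f₁} {f₂} {a} {e′} {e₂} h₁ h₂ (≤-reflexive (agree e′ e′≢e₁ e′≢e₂)) only-e₂
  from-e : ∀ {b} → ¬ CanTransfer H f₁ e b → ¬ CanTransfer H f₁ e e₁ → ¬ CanTransfer H f₂ e b
  from-e {b} =
    ¬canTransfer-from {f₁} {f₂} {e} {b} {e₁} h₁ h₂ (≤-reflexive (sym (agree e e≢e₁ e≢e₂))) only-e₁
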